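{- The following algorithm for $\operatorname{OR}$ is correct: on input lists $A_0,\dots,A_{m-1}$ its successive calls to next return, each exactly once, precisely the intervals of $\operatorname{OR}(A_0,\dots,A_{m-1})$, and then $\text{null}$. Algorithm: maintain a reference array holding one current interval per input list, and an indirect priority queue $Q$ of list indices ordered by the priority order $\trianglelefteq$ applied to the current intervals (ties broken arbitrarily). Initially the first interval of each $A_i$ is read into the reference array, $Q$ contains all indices, and $c\leftarrow[-\infty\..-\infty]$. The operation advance$(Q)$ takes the top index $i$; if $A_i$ is not exhausted it reads the next interval of $A_i$ into the reference array (and $Q$ is updated), otherwise it removes $i$ from $Q$. next: while $Q$ is nonempty and $c\subseteq$ top$(Q)$ (the current interval of the top index), do advance$(Q)$; if $Q$ is empty return $\text{null}$; set $c\leftarrow$ top$(Q)$ and return $c$.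
   Context: Let $O$ be a finite totally ordered set, accessed only through comparisons; $\pm\infty$ denote special elements strictly smaller/larger than every element of $O$. A subset $X\subseteq O$ is an interval if $x,y\in X$, $x<z<y$ imply $z\in X$; nonempty intervals are written $[\ell\..r]$ with left extreme $\ell$ and right extreme $r$. An antichain of intervals is a set of intervals pairwise incomparable under inclusion; its intervals are linearly ordered by left extremes (equivalently by right extremes), its natural order. The input consists of $m$ lists $A_0,\dots,A_{m-1}$, each a nonempty antichain of nonempty intervals delivered in natural order through a next function that returns $\text{null}$ once exhausted. $\operatorname{OR}(A_0,\dots,A_{m-1})$ is the set of inclusion-minimal intervals among those in $A_0\cup\dots\cup A_{m-1}$. The priority order $\trianglelefteq$ is defined by $[\ell\..r]\trianglelefteq[\ell'\..r']$ iff $r<r'$, or $r=r'$ and $\ell\ge\ell'$; the top of $Q$ is the index whose current interval is least for $\trianglelefteq$. -}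

module Defs where

open import Data.Nat using (ℕ; zero; suc)
open import Data.Fin using (Fin; _≟_)
open import Data.Product using (_×_; _,_; proj₁; proj₂; Σ; ∃)
open import Data.Sum using (_⊎_)
open import Data.Maybe using (Maybe; just; nothing)
open import Data.Empty using (⊥)
open import Data.List using (List; []; _∷_; filter; allFin)
open import Data.List.NonEmpty using (List⁺; toList) renaming (head to head⁺; tail to tail⁺)
open import Data.List.Membership.Propositional using (_∈_)
open import Data.List.Relation.Unary.Linked using (Linked)
open import Relation.Nullary using (¬_; yes; no; ¬?)

open import Relation.Binary.PropositionalEquality using (_≡_; _≢_)

-- A nonempty interval [ℓ..r] of O is represented by its pair of extremes (ℓ , r).
Interval : Set → Set
Interval O = O × O

Finite : Set → Set
Finite O = Σ (List O) (λ xs → ∀ x → x ∈ xs)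

module _ {O : Set} (_<_ : O → O → Set) where

  _≤_ : O → O → Set
  x ≤ y = (x < y) ⊎ (x ≡ y)

  _∈ᵢ_ : O → Interval O → Set
  z ∈ᵢ (l , r) = (l ≤ z) × (z ≤ r)

  _⊆ᵢ_ : Interval O → Interval O → Set
  I ⊆ᵢ J = ∀ z → z ∈ᵢ I → z ∈ᵢ J

  _⊴_ : Interval O → Interval O → Set
  (l , r) ⊴ (l' , r') = (r < r') ⊎ ((r ≡ r') × (l' ≤ l))

  -- a nonempty antichain of nonempty intervals listed in natural order
  -- (nonemptiness of the list is built into List⁺)
  IsInputList : List⁺ (Interval O) → Set
  IsInputList A =
    (∀ I → I ∈ toList A → proj₁ I ≤ proj₂ I)
    × (∀ I J → I ∈ toList A → J ∈ toList A → I ⊆ᵢ J → I ≡ J)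
    × Linked (λ I J → proj₁ I < proj₁ J) (toList A)

  -- I ∈ OR(A₀,…,A_{m-1}): I is an inclusion-minimal interval of A₀ ∪ … ∪ A_{m-1}
  InOR : {m : ℕ} → (Fin m → List⁺ (Interval O)) → Interval O → Set
  InOR {m} A I =
    (∃ λ i → I ∈ toList (A i))
    × (∀ (j : Fin m) J → J ∈ toList (A j) → J ⊆ᵢ I → I ⊆ᵢ J)

  -- c ⊆ I where c = nothing encodes the initial value [-∞..-∞];
  -- since -∞ ∈ [-∞..-∞] but -∞ ∉ I for any interval I of O, this is false.
  _⊆c_ : Maybe (Interval O) → Interval O → Set
  nothing ⊆c I = ⊥
  just c ⊆c I = c ⊆ᵢ I

-- State of the algorithm: reference array (current interval per list), the
-- unread remainders of the input lists, the contents of the queue Q, the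
-- variable c, and a step counter (so that tie-breaking policies may depend
-- on the whole history).
record State (O : Set) (m : ℕ) : Set where
  field
    cur  : Fin m → Interval O
    rem  : Fin m → List (Interval O)
    Q    : List (Fin m)
    c    : Maybe (Interval O)
    time : ℕ
open State public

update : {A : Set} {m : ℕ} → (Fin m → A) → Fin m → A → Fin m → A
update f i x j with j ≟ i
... | yes _ = x
... | no _ = f j

initState : {O : Set} {m : ℕ} → (Fin m → List⁺ (Interval O)) → State O m
initState {m = m} A = record
  { cur = λ i → head⁺ (A i)
  ; rem = λ i → tail⁺ (A i)
  ; Q = allFin m
  ; c = nothing
  ; time = 0
  }

ValidTop : {O : Set} (_<_ : O → O → Set) {m : ℕ} → (State O m → Fin m) → Set
ValidTop _<_ {m} top = ∀ s → Q s ≢ [] →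
  (top s ∈ Q s) × (∀ j → j ∈ Q s → _⊴_ _<_ (cur s (top s)) (cur s j))

module _ {O : Set} (_<_ : O → O → Set) {m : ℕ} (top : State O m → Fin m) where

  advanceWith : Fin m → List (Interval O) → State O m → State O m
  advanceWith i [] s = record s { Q = filter (λ j → ¬? (j ≟ i)) (Q s) ; time = suc (time s) }
  advanceWith i (x ∷ xs) s = record s
    { cur = update (cur s) i x ; rem = update (rem s) i xs ; time = suc (time s) }

  advance : State O m → State O m
  advance s = advanceWith (top s) (rem s (top s)) s

  data Loop : State O m → State O m → Set where
    exit-empty : ∀ {s} → Q s ≡ [] → Loop s s
    exit-cond  : ∀ {s} → Q s ≢ [] → ¬ (_⊆c_ _<_ (c s) (cur s (top s))) → Loop s s
    iterate    : ∀ {s s'} → Q s ≢ [] → _⊆c_ _<_ (c s) (cur s (top s)) →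
                 Loop (advance s) s' → Loop s s'

  -- one call to next: Next s r s' (r = nothing means null)
  data Next : State O m → Maybe (Interval O) → State O m → Set where
    ret-null : ∀ {s s₁} → Loop s s₁ → Q s₁ ≡ [] → Next s nothing s₁
    ret-int  : ∀ {s s₁} → Loop s s₁ → Q s₁ ≢ [] →
               Next s (just (cur s₁ (top s₁))) (record s₁ { c = just (cur s₁ (top s₁)) })

  data Run : State O m → List (Interval O) → Set where
    finish : ∀ {s s'} → Next s nothing s' → Run s []
    emit   : ∀ {s s' I outs} → Next s (just I) s' → Run s' outs → Run s (I ∷ outs)

-- Call an interval of A_j pending while j is queued and the interval is the current or an
-- unread one of A_j, and passed once its left extreme is at most that of c. Between calls to
-- next every input interval is pending or passed, and every queued current interval lies
-- ⊴-above c. An interval returned by next is then ⊴-least among the pending ones and does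
-- not contain c, so its left extreme exceeds that of c: no passed interval fits inside it,
-- and a pending one inside it must equal it, so it is inclusion-minimal. The left extremes
-- of the outputs strictly increase, so no interval is returned twice. Conversely, a minimal
-- interval stops being pending only when it is skipped while containing c, and minimality
-- then forces it to be c, an earlier output. Each advance consumes an unread interval or a
-- queue entry, so every call to next terminates.
module Submission where

open import Level using (0ℓ)
open import Data.Nat using (ℕ; _+_)
import Data.Nat as ℕ
import Data.Nat.Properties as ℕₚ
open import Data.Nat.Induction using (<-wellFounded)
open import Data.Nat.ListAction using (sum)
open import Data.Fin using (Fin; _≟_)
open import Data.Product using (_×_; _,_; proj₁; proj₂; Σ; Σ-syntax; ∃; uncurry)
open import Data.Sum using (_⊎_; inj₁; inj₂)
open import Data.Maybe using (Maybe; just; nothing)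
open import Data.Maybe.Relation.Unary.All as MaybeAll using (just; nothing)
open import Data.Maybe.Relation.Unary.Any as MaybeAny using (just)
open import Data.List using (List; []; _∷_; map; length; allFin)
open import Data.List.Properties using (filter-notAll; ≡-dec)
open import Data.List.NonEmpty using (List⁺; toList)
open import Data.List.Membership.Propositional using (_∈_)
open import Data.List.Membership.Propositional.Properties using (∈-filter⁺; ∈-filter⁻; ∈-allFin)
open import Data.List.Relation.Unary.Any using (here; there)
import Data.List.Relation.Unary.Any as Any
open import Data.List.Relation.Unary.Any.Properties using (¬Any[])
open import Data.List.Relation.Unary.All as All using (All; []; _∷_)
open import Data.List.Relation.Unary.AllPairs as AllPairs using (AllPairs; []; _∷_)
open import Data.List.Relation.Unary.Linked.Properties using (Linked⇒AllPairs)
open import Data.List.Relation.Unary.Unique.Propositional using (Unique)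
open import Function.Bundles using (_⇔_; mk⇔)
open import Induction.WellFounded using (Acc; acc)
open import Relation.Nullary using (¬_; Dec; yes; no; ¬?; contradiction)
open import Relation.Nullary.Decidable using (map′; _×-dec_)
open import Relation.Binary.Core using (Rel)
open import Relation.Binary.Definitions using (Reflexive; Transitive; Antisymmetric; Decidable; Trans; tri<; tri≈; tri>)
open import Relation.Binary.PropositionalEquality using (_≡_; _≢_; refl; sym; cong; cong₂; subst)
open import Relation.Binary.Structures using (IsStrictTotalOrder)
import Relation.Binary.Construct.StrictToNonStrict as StrictToNonStrict

open import Defs hiding (_≤_; _∈ᵢ_; _⊆ᵢ_; _⊴_; _⊆c_)
import Defs

module _ {A : Set} {f g : A → ℕ} (f≤g : ∀ x → f x ℕ.≤ g x) where

  sum-map-≤ : ∀ xs → sum (map f xs) ℕ.≤ sum (map g xs)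
  sum-map-≤ []       = ℕ.z≤n
  sum-map-≤ (x ∷ xs) = ℕₚ.+-mono-≤ (f≤g x) (sum-map-≤ xs)

  sum-map-< : ∀ {x xs} → x ∈ xs → f x ℕ.< g x → sum (map f xs) ℕ.< sum (map g xs)
  sum-map-< {xs = _ ∷ xs} (here refl) fx<gx = ℕₚ.+-mono-<-≤ fx<gx (sum-map-≤ xs)
  sum-map-< {xs = y ∷ _}  (there x∈xs) fx<gx = ℕₚ.+-mono-≤-< (f≤g y) (sum-map-< x∈xs fx<gx)

sum-update-< : ∀ {B : Set} {m} (h : B → ℕ) (f : Fin m → B) {i y} → h y ℕ.< h (f i) →
               sum (map (λ j → h (update f i y j)) (allFin m)) ℕ.< sum (map (λ j → h (f j)) (allFin m))
sum-update-< h f {i} {y} hy<hfi = sum-map-< pointwise (∈-allFin i) at-i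
  where
  pointwise : ∀ j → h (update f i y j) ℕ.≤ h (f j)
  pointwise j with j ≟ i
  ... | yes refl = ℕₚ.<⇒≤ hy<hfi
  ... | no _     = ℕₚ.≤-refl
  at-i : h (update f i y i) ℕ.< h (f i)
  at-i with i ≟ i
  ... | yes _  = hy<hfi
  ... | no i≢i = contradiction refl i≢i

module IntervalOrder {O : Set} {_<_ : Rel O 0ℓ} (sto : IsStrictTotalOrder _≡_ _<_) where

  open IsStrictTotalOrder sto using (compare; irrefl; isEquivalence; <-resp-≈; <-respˡ-≈)
    renaming (trans to <-trans)
  open StrictToNonStrict _≡_ _<_ using () renaming
    (trans to ≤-trans′; antisym to ≤-antisym′; ≤-<-trans to ≤-<-trans′; decidable′ to ≤-decidable)

  _≤_ : Rel O 0ℓ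
  _≤_ = Defs._≤_ _<_

  _⊆ᵢ_ : Rel (Interval O) 0ℓ
  _⊆ᵢ_ = Defs._⊆ᵢ_ _<_

  _⊴_ : Rel (Interval O) 0ℓ
  _⊴_ = Defs._⊴_ _<_

  _⊆c_ : Maybe (Interval O) → Interval O → Set
  _⊆c_ = Defs._⊆c_ _<_

  _<ˡ_ : Rel (Interval O) 0ℓ
  I <ˡ J = proj₁ I < proj₁ J

  NonEmpty : Interval O → Set
  NonEmpty (l , r) = l ≤ r

  ≤-refl : Reflexive _≤_
  ≤-refl = inj₂ refl

  ≤-trans : Transitive _≤_
  ≤-trans = ≤-trans′ isEquivalence <-resp-≈ <-trans

  ≤-antisym : Antisymmetric _≡_ _≤_
  ≤-antisym = ≤-antisym′ isEquivalence <-trans irrefl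

  ≤-<-trans : Trans _≤_ _<_ _<_
  ≤-<-trans = ≤-<-trans′ sym <-trans <-respˡ-≈

  _≤?_ : Decidable _≤_
  _≤?_ = ≤-decidable compare

  <⇒≱ : ∀ {x y} → x < y → ¬ (y ≤ x)
  <⇒≱ x<y y≤x = irrefl refl (≤-<-trans y≤x x<y)

  ≰⇒> : ∀ {x y} → ¬ (x ≤ y) → y < x
  ≰⇒> {x} {y} x≰y with compare x y
  ... | tri< x<y _ _ = contradiction (inj₁ x<y) x≰y
  ... | tri≈ _ x≡y _ = contradiction (inj₂ x≡y) x≰y
  ... | tri> _ _ y<x = y<x

  ⊆ᵢ-intro : ∀ {l r l′ r′} → l′ ≤ l → r ≤ r′ → (l , r) ⊆ᵢ (l′ , r′)
  ⊆ᵢ-intro l′≤l r≤r′ z (l≤z , z≤r) = ≤-trans l′≤l l≤z , ≤-trans z≤r r≤r′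

  ⊆ᵢ-extremes : ∀ {l r l′ r′} → l ≤ r → (l , r) ⊆ᵢ (l′ , r′) → l′ ≤ l × r ≤ r′
  ⊆ᵢ-extremes l≤r I⊆J = proj₁ (I⊆J _ (≤-refl , l≤r)) , proj₂ (I⊆J _ (l≤r , ≤-refl))

  ⊆ᵢ-antisym : ∀ {I J} → NonEmpty I → NonEmpty J → I ⊆ᵢ J → J ⊆ᵢ I → I ≡ J
  ⊆ᵢ-antisym neI neJ I⊆J J⊆I =
    cong₂ _,_ (≤-antisym (proj₁ J⊇I) (proj₁ I⊇J)) (≤-antisym (proj₂ I⊇J) (proj₂ J⊇I))
    where
    I⊇J = ⊆ᵢ-extremes neI I⊆J
    J⊇I = ⊆ᵢ-extremes neJ J⊆I

  _⊆ᵢ?_ : Decidable _⊆ᵢ_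
  (l , r) ⊆ᵢ? (l′ , r′) with l ≤? r
  ... | no l≰r  = yes λ z (l≤z , z≤r) → contradiction (≤-trans l≤z z≤r) l≰r
  ... | yes l≤r = map′ (uncurry ⊆ᵢ-intro) (⊆ᵢ-extremes l≤r) ((l′ ≤? l) ×-dec (r ≤? r′))

  _⊆c?_ : ∀ d I → Dec (d ⊆c I)
  nothing ⊆c? I = no λ ()
  just c  ⊆c? I = c ⊆ᵢ? I

  ⊴-refl : Reflexive _⊴_
  ⊴-refl = inj₂ (refl , ≤-refl)

  ⊴-trans : Transitive _⊴_
  ⊴-trans (inj₁ r<r′)          (inj₁ r′<r″)          = inj₁ (<-trans r<r′ r′<r″)
  ⊴-trans (inj₁ r<r′)          (inj₂ (refl , _))     = inj₁ r<r′
  ⊴-trans (inj₂ (refl , _))    (inj₁ r′<r″)          = inj₁ r′<r″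
  ⊴-trans (inj₂ (refl , l′≤l)) (inj₂ (refl , l″≤l′)) = inj₂ (refl , ≤-trans l″≤l′ l′≤l)

  ⊴-antisym : Antisymmetric _≡_ _⊴_
  ⊴-antisym (inj₁ r<r′)          (inj₁ r′<r)          = contradiction (<-trans r<r′ r′<r) (irrefl refl)
  ⊴-antisym (inj₁ r<r′)          (inj₂ (r′≡r , _))    = contradiction r<r′ (irrefl (sym r′≡r))
  ⊴-antisym (inj₂ (refl , _))    (inj₁ r<r)           = contradiction r<r (irrefl refl)
  ⊴-antisym (inj₂ (refl , l′≤l)) (inj₂ (_ , l≤l′))    = cong₂ _,_ (≤-antisym l≤l′ l′≤l) refl

  ⊴∧⊇ᵢ⇒⊆ᵢ : ∀ {I J} → NonEmpty J → I ⊴ J → J ⊆ᵢ I → I ⊆ᵢ J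
  ⊴∧⊇ᵢ⇒⊆ᵢ neJ (inj₁ r<r′)          J⊆I = contradiction (proj₂ (⊆ᵢ-extremes neJ J⊆I)) (<⇒≱ r<r′)
  ⊴∧⊇ᵢ⇒⊆ᵢ neJ (inj₂ (r≡r′ , l′≤l)) J⊆I = ⊆ᵢ-intro l′≤l (inj₂ r≡r′)

  ⊴∧⊈ᵢ⇒<ˡ : ∀ {I J} → I ⊴ J → ¬ (I ⊆ᵢ J) → I <ˡ J
  ⊴∧⊈ᵢ⇒<ˡ I⊴J I⊈J = ≰⇒> λ l′≤l → I⊈J (⊆ᵢ-intro l′≤l (right≤ I⊴J))
    where
    right≤ : ∀ {I J} → I ⊴ J → proj₂ I ≤ proj₂ J
    right≤ (inj₁ r<r′)      = inj₁ r<r′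
    right≤ (inj₂ (r≡r′ , _)) = inj₂ r≡r′

  input-<ˡ⇒⊴ : ∀ {A I J} → IsInputList _<_ A → I ∈ toList A → J ∈ toList A → I <ˡ J → I ⊴ J
  input-<ˡ⇒⊴ (_ , antichain , _) I∈A J∈A l<l′ = inj₁ (≰⇒> λ r′≤r →
    irrefl (cong proj₁ (sym (antichain _ _ J∈A I∈A (⊆ᵢ-intro (inj₁ l<l′) r′≤r)))) l<l′)

module Algorithm {O : Set} {_<_ : Rel O 0ℓ} (sto : IsStrictTotalOrder _≡_ _<_)
  {m : ℕ} (A : Fin m → List⁺ (Interval O)) (inputs : ∀ i → IsInputList _<_ (A i))
  (top : State O m → Fin m) (validTop : ValidTop _<_ top) where

  open IntervalOrder sto
  open IsStrictTotalOrder sto using (irrefl) renaming (trans to <-trans)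

  St : Set
  St = State O m

  upcoming : St → Fin m → List (Interval O)
  upcoming s j = cur s j ∷ rem s j

  Pending : St → Fin m → Interval O → Set
  Pending s j J = j ∈ Q s × J ∈ upcoming s j

  FromInput : Interval O → Set
  FromInput I = ∃ λ i → I ∈ toList (A i)

  -- nothing stands for c = [-∞..-∞]: no interval is passed and every interval lies right of it.
  Passed : Maybe (Interval O) → Interval O → Set
  Passed d J = MaybeAny.Any (λ c → proj₁ J ≤ proj₁ c) d

  RightOf : Maybe (Interval O) → Interval O → Set
  RightOf d I = MaybeAll.All (_<ˡ I) d

  -- The last output d is a parameter rather than c s, since c (advanceAt i s) ≡ c s holds only
  -- propositionally.
  record Invariant (d : Maybe (Interval O)) (s : St) : Set where
    field
      upcoming-input    : ∀ j {J} → J ∈ upcoming s j → J ∈ toList (A j)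
      upcoming-sorted   : ∀ j → AllPairs _<ˡ_ (upcoming s j)
      queued-above      : ∀ {j} → j ∈ Q s → MaybeAll.All (_⊴ cur s j) d
      pending-or-passed : ∀ j {J} → J ∈ toList (A j) → Pending s j J ⊎ Passed d J
      from-input        : MaybeAll.All FromInput d
  open Invariant

  fromInput-nonEmpty : ∀ {I} → FromInput I → NonEmpty I
  fromInput-nonEmpty (i , I∈A) = proj₁ (inputs i) _ I∈A

  ⊆c⇒Passed : ∀ {d J} → MaybeAll.All FromInput d → d ⊆c J → Passed d J
  ⊆c⇒Passed (just c∈A) c⊆J = just (proj₁ (⊆ᵢ-extremes (fromInput-nonEmpty c∈A) c⊆J))

  Passed∧RightOf⇒<ˡ : ∀ {d I J} → Passed d J → RightOf d I → J <ˡ I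
  Passed∧RightOf⇒<ˡ (just l≤lc) (just lc<l′) = ≤-<-trans l≤lc lc<l′

  RightOf-trans : ∀ {d I J} → RightOf d I → RightOf (just I) J → RightOf d J
  RightOf-trans d<I (just I<J) = MaybeAll.map (λ c<I → <-trans c<I I<J) d<I

  ⊴∧⊈c⇒RightOf : ∀ {d I} → MaybeAll.All (_⊴ I) d → ¬ (d ⊆c I) → RightOf d I
  ⊴∧⊈c⇒RightOf nothing     _   = nothing
  ⊴∧⊈c⇒RightOf (just c⊴I) c⊈I = just (⊴∧⊈ᵢ⇒<ˡ c⊴I c⊈I)

  ⊆c-InOR⇒≡ : ∀ {d K} → MaybeAll.All FromInput d → InOR _<_ A K → d ⊆c K → just K ≡ d
  ⊆c-InOR⇒≡ (just c∈A@(j , c∈Aj)) (K∈A , minimal) c⊆K =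
    cong just (⊆ᵢ-antisym (fromInput-nonEmpty K∈A) (fromInput-nonEmpty c∈A) (minimal j _ c∈Aj c⊆K) c⊆K)

  cur-⊴-upcoming : ∀ {d s j J} → Invariant d s → J ∈ upcoming s j → cur s j ⊴ J
  cur-⊴-upcoming inv (here refl) = ⊴-refl
  cur-⊴-upcoming {j = j} inv (there J∈rem) =
    input-<ˡ⇒⊴ (inputs j) (upcoming-input inv j (here refl)) (upcoming-input inv j (there J∈rem))
      (All.lookup (AllPairs.head (upcoming-sorted inv j)) J∈rem)

  advanceAt : Fin m → St → St
  advanceAt i s = advanceWith _<_ top i (rem s i) s

  advanceAt-c : ∀ i s → c (advanceAt i s) ≡ c s
  advanceAt-c i s with rem s i
  ... | []    = refl
  ... | _ ∷ _ = refl

  advanceAt-Q : ∀ i s {j} → j ∈ Q (advanceAt i s) → j ∈ Q s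
  advanceAt-Q i s with rem s i
  ... | []    = λ j∈Q′ → proj₁ (∈-filter⁻ (λ j → ¬? (j ≟ i)) j∈Q′)
  ... | _ ∷ _ = λ j∈Q′ → j∈Q′

  advanceAt-upcoming : ∀ i s j →
    upcoming (advanceAt i s) j ≡ upcoming s j ⊎ upcoming s j ≡ cur s j ∷ upcoming (advanceAt i s) j
  advanceAt-upcoming i s j with rem s i in eq
  ... | []     = inj₁ refl
  ... | x ∷ xs with j ≟ i
  ...   | yes refl = inj₂ (cong (cur s i ∷_) eq)
  ...   | no _     = inj₁ refl

  advanceAt-pending : ∀ {i s j J} → Pending s j J → Pending (advanceAt i s) j J ⊎ J ≡ cur s i
  advanceAt-pending {i} {s} {j} (j∈Q , J∈) with rem s i in eq
  ... | [] with j ≟ i | J∈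
  ...   | no j≢i   | _           = inj₁ (∈-filter⁺ (λ k → ¬? (k ≟ i)) j∈Q j≢i , J∈)
  ...   | yes refl | here refl   = inj₂ refl
  ...   | yes refl | there J∈rem = contradiction (subst (_ ∈_) eq J∈rem) ¬Any[]
  advanceAt-pending {i} {s} {j} (j∈Q , J∈) | x ∷ xs with j ≟ i | J∈
  ...   | no _     | _           = inj₁ (j∈Q , J∈)
  ...   | yes refl | here refl   = inj₂ refl
  ...   | yes refl | there J∈rem = inj₁ (j∈Q , subst (_ ∈_) eq J∈rem)

  advanceAt-upcoming-⊆ : ∀ i s {j J} → J ∈ upcoming (advanceAt i s) j → J ∈ upcoming s j
  advanceAt-upcoming-⊆ i s {j} {J} J∈ with advanceAt-upcoming i s j
  ... | inj₁ same = subst (J ∈_) same J∈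
  ... | inj₂ tail = subst (J ∈_) (sym tail) (there J∈)

  advanceAt-sorted : ∀ i s j → AllPairs _<ˡ_ (upcoming s j) → AllPairs _<ˡ_ (upcoming (advanceAt i s) j)
  advanceAt-sorted i s j sorted with advanceAt-upcoming i s j
  ... | inj₁ same = subst (AllPairs _<ˡ_) (sym same) sorted
  ... | inj₂ tail = AllPairs.tail (subst (AllPairs _<ˡ_) tail sorted)

  advanceAt-invariant : ∀ {d i s} → d ⊆c cur s i → Invariant d s → Invariant d (advanceAt i s)
  advanceAt-invariant {d} {i} {s} d⊆cur inv = record
    { upcoming-input    = λ j J∈ → upcoming-input inv j (advanceAt-upcoming-⊆ i s J∈)
    ; upcoming-sorted   = λ j → advanceAt-sorted i s j (upcoming-sorted inv j)
    ; queued-above      = λ j∈Q′ →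
                            MaybeAll.map (λ d⊴ → ⊴-trans d⊴ cur⊴cur′) (queued-above inv (advanceAt-Q i s j∈Q′))
    ; pending-or-passed = pending-or-passed′
    ; from-input        = from-input inv
    }
    where
    cur⊴cur′ : ∀ {j} → cur s j ⊴ cur (advanceAt i s) j
    cur⊴cur′ = cur-⊴-upcoming inv (advanceAt-upcoming-⊆ i s (here refl))
    pending-or-passed′ : ∀ j {J} → J ∈ toList (A j) → Pending (advanceAt i s) j J ⊎ Passed d J
    pending-or-passed′ j J∈A with pending-or-passed inv j J∈A
    ... | inj₂ passed = inj₂ passed
    ... | inj₁ pending with advanceAt-pending {i} {s} pending
    ...   | inj₁ pending′ = inj₁ pending′
    ...   | inj₂ refl     = inj₂ (⊆c⇒Passed (from-input inv) d⊆cur)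

  advanceAt-pending-InOR : ∀ {d i s j K} → d ⊆c cur s i → Invariant d s → InOR _<_ A K → Pending s j K →
                   Pending (advanceAt i s) j K ⊎ just K ≡ d
  advanceAt-pending-InOR {i = i} {s} d⊆cur inv K∈OR pending with advanceAt-pending {i} {s} pending
  ... | inj₁ pending′ = inj₁ pending′
  ... | inj₂ refl     = inj₂ (⊆c-InOR⇒≡ (from-input inv) K∈OR d⊆cur)

  top-queued : ∀ s → Q s ≢ [] → top s ∈ Q s
  top-queued s ne = proj₁ (validTop s ne)

  top-least : ∀ s {j} → Q s ≢ [] → j ∈ Q s → cur s (top s) ⊴ cur s j
  top-least s ne = proj₂ (validTop s ne) _

  top-ignores-c : ∀ {s d} → Q s ≢ [] → cur s (top record s { c = d }) ≡ cur s (top s)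
  top-ignores-c {s} {d} ne =
    ⊴-antisym (top-least s′ ne (top-queued s ne)) (top-least s ne (top-queued s′ ne))
    where
    s′ : St
    s′ = record s { c = d }

  output-right-of : ∀ {d s} → Q s ≢ [] → Invariant d s → ¬ (d ⊆c cur s (top s)) →
                    RightOf d (cur s (top s))
  output-right-of {s = s} ne inv d⊈top = ⊴∧⊈c⇒RightOf (queued-above inv (top-queued s ne)) d⊈top

  output-InOR : ∀ {d s} → Q s ≢ [] → Invariant d s → ¬ (d ⊆c cur s (top s)) →
                InOR _<_ A (cur s (top s))
  output-InOR {d} {s} ne inv d⊈top = (top s , upcoming-input inv (top s) (here refl)) , minimal
    where
    minimal : ∀ j J → J ∈ toList (A j) → J ⊆ᵢ cur s (top s) → cur s (top s) ⊆ᵢ J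
    minimal j J J∈A J⊆top with pending-or-passed inv j J∈A
    ... | inj₁ (j∈Q , J∈) =
      ⊴∧⊇ᵢ⇒⊆ᵢ (fromInput-nonEmpty (j , J∈A)) (⊴-trans (top-least s ne j∈Q) (cur-⊴-upcoming inv J∈)) J⊆top
    ... | inj₂ passed =
      contradiction (proj₁ (⊆ᵢ-extremes (fromInput-nonEmpty (j , J∈A)) J⊆top))
                    (<⇒≱ (Passed∧RightOf⇒<ˡ {I = cur s (top s)} {J} passed (output-right-of ne inv d⊈top)))

  output-invariant : ∀ {d s} → Q s ≢ [] → Invariant d s → ¬ (d ⊆c cur s (top s)) →
                     Invariant (just (cur s (top s))) record s { c = just (cur s (top s)) }
  output-invariant {d} {s} ne inv d⊈top = record
    { upcoming-input    = upcoming-input inv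
    ; upcoming-sorted   = upcoming-sorted inv
    ; queued-above      = λ j∈Q → just (top-least s ne j∈Q)
    ; pending-or-passed = pending-or-passed′
    ; from-input        = just (top s , upcoming-input inv (top s) (here refl))
    }
    where
    pending-or-passed′ : ∀ j {J} → J ∈ toList (A j) → Pending s j J ⊎ Passed (just (cur s (top s))) J
    pending-or-passed′ j {J} J∈A with pending-or-passed inv j J∈A
    ... | inj₁ pending = inj₁ pending
    ... | inj₂ passed  =
      inj₂ (just (inj₁ (Passed∧RightOf⇒<ˡ {I = cur s (top s)} {J} passed (output-right-of ne inv d⊈top))))

  loop-invariant : ∀ {d s s₁} → Loop _<_ top s s₁ → c s ≡ d → Invariant d s → Invariant d s₁
  loop-invariant (exit-empty _)          _    inv = inv
  loop-invariant (exit-cond _ _)         _    inv = inv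
  loop-invariant {s = s} (iterate _ c⊆top loop) refl inv =
    loop-invariant loop (advanceAt-c (top s) s) (advanceAt-invariant c⊆top inv)

  loop-exit : ∀ {d s s₁} → Loop _<_ top s s₁ → c s ≡ d → Q s₁ ≢ [] → ¬ (d ⊆c cur s₁ (top s₁))
  loop-exit (exit-empty empty)      _    ne = contradiction empty ne
  loop-exit (exit-cond _ c⊈top)     refl _  = c⊈top
  loop-exit {s = s} (iterate _ _ loop) refl ne = loop-exit loop (advanceAt-c (top s) s) ne

  loop-pending-InOR : ∀ {d s s₁ j K} → Loop _<_ top s s₁ → c s ≡ d → Invariant d s →
                      InOR _<_ A K → Pending s j K → (∃ λ j′ → Pending s₁ j′ K) ⊎ just K ≡ d
  loop-pending-InOR (exit-empty _)  _ _ _ pending = inj₁ (_ , pending)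
  loop-pending-InOR (exit-cond _ _) _ _ _ pending = inj₁ (_ , pending)
  loop-pending-InOR {s = s} (iterate _ c⊆top loop) refl inv K∈OR pending
    with advanceAt-pending-InOR {i = top s} {s} c⊆top inv K∈OR pending
  ... | inj₂ K≡c     = inj₂ K≡c
  ... | inj₁ pending′ =
    loop-pending-InOR loop (advanceAt-c (top s) s) (advanceAt-invariant c⊆top inv) K∈OR pending′

  next-c : ∀ {s s′ I} → Next _<_ top s (just I) s′ → c s′ ≡ just I
  next-c (ret-int _ _) = refl

  next-invariant : ∀ {d s s′ I} → Next _<_ top s (just I) s′ → c s ≡ d → Invariant d s → Invariant (just I) s′
  next-invariant (ret-int loop ne) c≡d inv =
    output-invariant ne (loop-invariant loop c≡d inv) (loop-exit loop c≡d ne)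

  next-right-of : ∀ {d s s′ I} → Next _<_ top s (just I) s′ → c s ≡ d → Invariant d s → RightOf d I
  next-right-of (ret-int loop ne) c≡d inv =
    output-right-of ne (loop-invariant loop c≡d inv) (loop-exit loop c≡d ne)

  next-InOR : ∀ {d s s′ I} → Next _<_ top s (just I) s′ → c s ≡ d → Invariant d s → InOR _<_ A I
  next-InOR (ret-int loop ne) c≡d inv =
    output-InOR ne (loop-invariant loop c≡d inv) (loop-exit loop c≡d ne)

  run-InOR : ∀ {d s outs} → Run _<_ top s outs → c s ≡ d → Invariant d s → All (InOR _<_ A) outs
  run-InOR (finish _)      _   _   = []
  run-InOR (emit next run) c≡d inv =
    next-InOR next c≡d inv ∷ run-InOR run (next-c next) (next-invariant next c≡d inv)

  run-right-of : ∀ {d s outs} → Run _<_ top s outs → c s ≡ d → Invariant d s → All (RightOf d) outs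
  run-right-of (finish _)      _   _   = []
  run-right-of (emit next run) c≡d inv =
    I-right ∷ All.map (λ {J} → RightOf-trans {J = J} I-right)
                      (run-right-of run (next-c next) (next-invariant next c≡d inv))
    where
    I-right = next-right-of next c≡d inv

  run-sorted : ∀ {d s outs} → Run _<_ top s outs → c s ≡ d → Invariant d s → AllPairs _<ˡ_ outs
  run-sorted (finish _)      _   _   = []
  run-sorted (emit next run) c≡d inv =
    All.map MaybeAll.drop-just (run-right-of run (next-c next) inv′) ∷ run-sorted run (next-c next) inv′
    where
    inv′ = next-invariant next c≡d inv

  run-complete : ∀ {d s outs j K} → Run _<_ top s outs → c s ≡ d → Invariant d s →
                 InOR _<_ A K → Pending s j K → K ∈ outs ⊎ just K ≡ d
  run-complete (finish (ret-null loop empty)) c≡d inv K∈OR pending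
    with loop-pending-InOR loop c≡d inv K∈OR pending
  ... | inj₁ (_ , j∈Q , _) = contradiction (subst (_ ∈_) empty j∈Q) ¬Any[]
  ... | inj₂ K≡c           = inj₂ K≡c
  run-complete (emit next@(ret-int loop _) run) c≡d inv K∈OR pending
    with loop-pending-InOR loop c≡d inv K∈OR pending
  ... | inj₂ K≡c           = inj₂ K≡c
  ... | inj₁ (_ , pending′) with run-complete run refl (next-invariant next c≡d inv) K∈OR pending′
  ...   | inj₁ K∈outs = inj₁ (there K∈outs)
  ...   | inj₂ refl   = inj₁ (here refl)

  μ : St → ℕ
  μ s = length (Q s) + sum (map (λ j → length (rem s j)) (allFin m))

  advanceAt-μ : ∀ i s → i ∈ Q s → μ (advanceAt i s) ℕ.< μ s
  advanceAt-μ i s i∈Q with rem s i in eq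
  ... | []     = ℕₚ.+-monoˡ-< _
                   (filter-notAll (λ j → ¬? (j ≟ i)) (Q s) (Any.map (λ i≡j j≢i → j≢i (sym i≡j)) i∈Q))
  ... | x ∷ xs = ℕₚ.+-monoʳ-< (length (Q s))
                   (sum-update-< length (rem s) (subst (λ r → length xs ℕ.< length r) (sym eq) (ℕₚ.n<1+n _)))

  loop-exists : ∀ s → Acc ℕ._<_ (μ s) → Σ[ s₁ ∈ St ] Loop _<_ top s s₁ × μ s₁ ℕ.≤ μ s
  loop-exists s (acc rec) with ≡-dec _≟_ (Q s) []
  ... | yes empty = s , exit-empty empty , ℕₚ.≤-refl
  ... | no ne with c s ⊆c? cur s (top s)
  ...   | no c⊈top  = s , exit-cond ne c⊈top , ℕₚ.≤-refl
  ...   | yes c⊆top =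
    let s₁ , loop , μ≤ = loop-exists (advanceAt (top s) s) (rec μ<)
    in s₁ , iterate ne c⊆top loop , ℕₚ.≤-trans μ≤ (ℕₚ.<⇒≤ μ<)
    where
    μ< = advanceAt-μ (top s) s (top-queued s ne)

  -- After an output, c is the top interval itself, so the loop advances at least once.
  loop-after-output : ∀ s → Q s ≢ [] →
    Σ[ s₂ ∈ St ] Loop _<_ top (record s { c = just (cur s (top s)) }) s₂ × μ s₂ ℕ.< μ s
  loop-after-output s ne =
    let s₂ , loop , μ≤ = loop-exists (advanceAt (top s′) s′) (<-wellFounded _)
    in s₂ , iterate ne top⊆top loop , ℕₚ.≤-<-trans μ≤ (advanceAt-μ (top s′) s′ (top-queued s′ ne))
    where
    s′ : St
    s′ = record s { c = just (cur s (top s)) }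
    top⊆top : just (cur s (top s)) ⊆c cur s (top s′)
    top⊆top = subst (cur s (top s) ⊆ᵢ_) (sym (top-ignores-c {s} ne)) (λ _ z∈ → z∈)

  run-exists : ∀ {s s₁} → Loop _<_ top s s₁ → Acc ℕ._<_ (μ s₁) → ∃ (Run _<_ top s)
  run-exists {s₁ = s₁} loop (acc rec) with ≡-dec _≟_ (Q s₁) []
  ... | yes empty = [] , finish (ret-null loop empty)
  ... | no ne =
    let s₂ , loop′ , μ< = loop-after-output s₁ ne
        outs , run = run-exists loop′ (rec μ<)
    in cur s₁ (top s₁) ∷ outs , emit (ret-int loop ne) run

  initial-invariant : Invariant nothing (initState A)
  initial-invariant = record
    { upcoming-input    = λ _ J∈ → J∈
    ; upcoming-sorted   = λ j → Linked⇒AllPairs <-trans (proj₂ (proj₂ (inputs j)))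
    ; queued-above      = λ _ → nothing
    ; pending-or-passed = λ j J∈ → inj₁ (∈-allFin j , J∈)
    ; from-input        = nothing
    }

  initial-run : ∃ (Run _<_ top (initState A))
  initial-run =
    let _ , loop , _ = loop-exists (initState A) (<-wellFounded _) in run-exists loop (<-wellFounded _)

  initial-run-unique : ∀ {outs} → Run _<_ top (initState A) outs → Unique outs
  initial-run-unique run =
    AllPairs.map (λ I<J I≡J → irrefl (cong proj₁ I≡J) I<J) (run-sorted run refl initial-invariant)

  initial-run-OR : ∀ {outs} → Run _<_ top (initState A) outs → ∀ I → (I ∈ outs) ⇔ InOR _<_ A I
  initial-run-OR {outs} run I = mk⇔ (All.lookup (run-InOR run refl initial-invariant)) complete
    where
    complete : InOR _<_ A I → I ∈ outs
    complete I∈OR@((j , I∈A) , _) with run-complete run refl initial-invariant I∈OR (∈-allFin j , I∈A)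
    ... | inj₁ I∈outs = I∈outs
    ... | inj₂ ()

mainTheorem3 : {O : Set} (_<_ : O → O → Set) → IsStrictTotalOrder _≡_ _<_ → Finite O →
    {m : ℕ} (A : Fin m → List⁺ (Interval O)) → (∀ i → IsInputList _<_ (A i)) →
    (top : State O m → Fin m) → ValidTop _<_ top →
    Σ (List (Interval O)) (λ outs → Run _<_ top (initState A) outs)
    × (∀ outs → Run _<_ top (initState A) outs →
         Unique outs × (∀ I → (I ∈ outs) ⇔ InOR _<_ A I))
mainTheorem3 _<_ sto _ A inputs top validTop =
  initial-run , λ _ run → initial-run-unique run , initial-run-OR run
  where open Algorithm sto A inputs top validTop
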